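{- Let $\mathfrak q$ be a characteristic expansion of a causal strategy $\mathfrak p$, and $Y$ a clone class (equivalence class for $\approx$) of positive events in $|\mathfrak q|$, with $\sharp Y = \sum_{i\in I} 2^i$ for $I \subseteq \mathbb{N}$ finite. Then, for all $i \in \mathbb{N}$, $i\in I$ iff there is a fork $X_i$ of $\mathfrak q$ with $\sharp X_i = 2^i$ and $a^- \in X_i$, $b^+ \in Y$ such that $a^- \prec_{\mathfrak q} b^+$.
   Context: $A$ well-opened arena; $\prec$ denotes immediate causality in any order. Augmentation $\mathfrak q$: events $|\mathfrak q|$, configuration $D(\mathfrak q)=(|\mathfrak q|,\le_{D(\mathfrak q)},\partial_{\mathfrak q})$, tree order $\le_{\mathfrak q}$, rule-abiding ($\le_{D(\mathfrak q)}\subseteq\le_{\mathfrak q}$), courteous, deterministic ($a^-\prec_{\mathfrak q}a_1^+,a_2^+\Rightarrow a_1=a_2$); $\mathrm{init}(\mathfrak q)$ root; $\mathrm{just}(a)$ the unique $a''\prec_{D(\mathfrak q)}a$. Causal strategy: receptive, $-$-linear augmentation. Expansion $\mathfrak q\in\mathrm{Exp}(\mathfrak p)$: morphism $\mathfrak q\to\mathfrak p$ (preserving $\partial$, $\prec_{\mathfrak q}$, $\prec_{D(\mathfrak q)}$) which is $+$-obsessional. A fork is a maximal non-empty set of negative events with a common $\prec_{\mathfrak q}$-predecessor (or $\{\mathrm{init}(\mathfrak q)\}$) and equal displays. A characteristic expansion is an expansion where distinct forks have distinct cardinalities, each fork has cardinality a power of $2$, and which is $-$-obsessional (for $a^+$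 with $\partial(a)\prec_A b^-$ there is $a\prec_{\mathfrak q}a'$ with $\partial(a')=b$). Clones: for events $a,b$ of $\mathfrak q$, $a\approx b$ iff there is a context $\Gamma$ (display-preserving bijection between negative events) preserving pointers ($\mathrm{just}(a')=\mathrm{just}(\Gamma(a'))$) such that $a\sim^{\mathrm{id}}_\Gamma b$, where $\sim^\varphi_\Gamma$ is the bisimulation: (a) equal displays and no element of $\mathrm{dom}(\Gamma)$ (resp. $\mathrm{cod}(\Gamma)$) strictly above $a$ (resp. $b$); (b) for $a$ positive with $\mathrm{just}(a)\in\mathrm{dom}(\Gamma)$: $\Gamma(\mathrm{just}(a))=\mathrm{just}(b)$; (c) for $a$ positive with $\mathrm{just}(a)\notin\mathrm{dom}(\Gamma)$: $\mathrm{just}(b)\notin\mathrm{cod}(\Gamma)$ and $\varphi(\mathrm{just}(a))=\mathrm{just}(b)$; (1) for $a$ positive each successor $a'$ is matched by a successor $b'$ with $a'\sim^\varphi_{\Gamma\cup\{(a',b')\}}b'$ and symmetrically; (2) for $a$ negative each successor is matched with $\sim^\varphi_\Gamma$, and symmetrically. $\approx$ is an equivalence relation. -}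

module Defs where

open import Data.Nat using (ℕ; _^_)
open import Data.Fin using (Fin)
open import Data.Fin.Subset using (Subset; _∈_; ∣_∣) public
open import Data.Maybe using (Maybe; just; nothing)
open import Data.Product using (Σ; ∃; _×_; _,_)
open import Data.Sum using (_⊎_)
open import Data.List using (List; _∷_)
import Data.List.Membership.Propositional as LM
open import Relation.Nullary using (¬_)
open import Relation.Binary.PropositionalEquality using (_≡_)
open import Relation.Binary.Construct.Closure.ReflexiveTransitive using (Star)

data Pol : Set where
  pos neg : Pol

-- Finite forests given by a partial "parent" function (immediate causality)

Imm : ∀ {n} → (Fin n → Maybe (Fin n)) → Fin n → Fin n → Set
Imm par a b = par b ≡ just a

Le : ∀ {n} → (Fin n → Maybe (Fin n)) → Fin n → Fin n → Set
Le par = Star (Imm par)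

Lt : ∀ {n} → (Fin n → Maybe (Fin n)) → Fin n → Fin n → Set
Lt par a b = ∃ λ c → Imm par a c × Le par c b

Acyclic : ∀ {n} → (Fin n → Maybe (Fin n)) → Set
Acyclic par = ∀ a b → Le par a b → Le par b a → a ≡ b

record Arena : Set where
  field
    size        : ℕ
    polA        : Fin size → Pol
    parA        : Fin size → Maybe (Fin size)
    acyclicA    : Acyclic parA
    minNegA     : ∀ m → parA m ≡ nothing → polA m ≡ neg
    alternating : ∀ m m' → parA m ≡ just m' → ¬ (polA m' ≡ polA m)
open Arena public

WellOpened : Arena → Set
WellOpened A = ∃ λ m → parA A m ≡ nothing × (∀ m' → parA A m' ≡ nothing → m' ≡ m)

record Augmentation (A : Arena) : Set where
  field
    nev   : ℕ                                  -- |q| = Fin nev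
    disp  : Fin nev → Fin (size A)
    dpar  : Fin nev → Maybe (Fin nev)          -- ≺_{D(q)}
    qpar  : Fin nev → Maybe (Fin nev)          -- ≺_q
    -- D(q) is a configuration of !A displayed by ∂_q
    dAcyclic  : Acyclic dpar
    dispMin   : ∀ a → dpar a ≡ nothing → parA A (disp a) ≡ nothing
    dispSucc  : ∀ a a' → dpar a ≡ just a' → parA A (disp a) ≡ just (disp a')
    qAcyclic  : Acyclic qpar
    qTree     : ∀ a b → qpar a ≡ nothing → qpar b ≡ nothing → a ≡ b
    ruleAbiding : ∀ a b → Le dpar a b → Le qpar a b
    courteous : ∀ a b → Imm qpar a b →
                (polA A (disp a) ≡ pos ⊎ polA A (disp b) ≡ neg) → Imm dpar a b
    deterministic : ∀ a b₁ b₂ → polA A (disp a) ≡ neg →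
                    Imm qpar a b₁ → Imm qpar a b₂ →
                    polA A (disp b₁) ≡ pos → polA A (disp b₂) ≡ pos → b₁ ≡ b₂
open Augmentation public

module _ {A : Arena} where

  pol : (q : Augmentation A) → Fin (nev q) → Pol
  pol q a = polA A (disp q a)

  Receptive : Augmentation A → Set
  Receptive q = ∀ a b → pol q a ≡ pos → parA A b ≡ just (disp q a) → polA A b ≡ neg →
                ∃ λ a' → Imm (qpar q) a a' × disp q a' ≡ b

  NegLinear : Augmentation A → Set
  NegLinear q = ∀ a a₁ a₂ → Imm (qpar q) a a₁ → Imm (qpar q) a a₂ →
                pol q a₁ ≡ neg → pol q a₂ ≡ neg → disp q a₁ ≡ disp q a₂ → a₁ ≡ a₂

  record CausalStrategy (p : Augmentation A) : Set where
    field
      receptive : Receptive p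
      negLinear : NegLinear p

  NegObsessional : Augmentation A → Set
  NegObsessional = Receptive

  record Morphism (q p : Augmentation A) : Set where
    field
      fun      : Fin (nev q) → Fin (nev p)
      presDisp : ∀ a → disp p (fun a) ≡ disp q a
      presQ    : ∀ a b → Imm (qpar q) a b → Imm (qpar p) (fun a) (fun b)
      presD    : ∀ a b → Imm (dpar q) a b → Imm (dpar p) (fun a) (fun b)
  open Morphism public

  PosObsessional : {q p : Augmentation A} → Morphism q p → Set
  PosObsessional {q} {p} f = ∀ a b → pol p b ≡ pos → Imm (qpar p) (fun f a) b →
                             ∃ λ a' → Imm (qpar q) a a' × fun f a' ≡ b

  Expansion : Augmentation A → Augmentation A → Set
  Expansion q p = Σ (Morphism q p) PosObsessional

  -- forks: maximal non-empty sets of negative events with a common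
  -- ≺_q-predecessor (or = {init(q)}) and equal displays
  record Fork (q : Augmentation A) (X : Subset (nev q)) : Set where
    field
      nonEmpty : ∃ λ x → x ∈ X
      negative : ∀ x → x ∈ X → pol q x ≡ neg
      sameDisp : ∀ x y → x ∈ X → y ∈ X → disp q x ≡ disp q y
      samePred : ∀ x y → x ∈ X → y ∈ X → qpar q x ≡ qpar q y
      maximal  : ∀ x y → x ∈ X → pol q y ≡ neg → disp q y ≡ disp q x →
                 qpar q y ≡ qpar q x → y ∈ X

  record Characteristic (q p : Augmentation A) : Set where
    field
      expansion     : Expansion q p
      distinctCard  : ∀ X X' → Fork q X → Fork q X' → ∣ X ∣ ≡ ∣ X' ∣ → X ≡ X'
      powerOfTwo    : ∀ X → Fork q X → ∃ λ k → ∣ X ∣ ≡ 2 ^ k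
      negObsessional : NegObsessional q

  module _ (q : Augmentation A) where

    Ctx : Set
    Ctx = List (Fin (nev q) × Fin (nev q))

    _∈Γ_ : Fin (nev q) × Fin (nev q) → Ctx → Set
    _∈Γ_ = LM._∈_

    record IsContext (Γ : Ctx) : Set where
      field
        negDom     : ∀ x y → (x , y) ∈Γ Γ → pol q x ≡ neg
        negCod     : ∀ x y → (x , y) ∈Γ Γ → pol q y ≡ neg
        dispPres   : ∀ x y → (x , y) ∈Γ Γ → disp q x ≡ disp q y
        functional : ∀ x y y' → (x , y) ∈Γ Γ → (x , y') ∈Γ Γ → y ≡ y'
        injective  : ∀ x x' y → (x , y) ∈Γ Γ → (x' , y) ∈Γ Γ → x ≡ x'

    PreservesPointers : Ctx → Set
    PreservesPointers Γ = ∀ x y → (x , y) ∈Γ Γ → dpar q x ≡ dpar q y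

    data Bisim (φ : Fin (nev q) → Fin (nev q)) : Ctx → Fin (nev q) → Fin (nev q) → Set where
      bisim : ∀ {Γ a b} →
        disp q a ≡ disp q b →
        (∀ x y → (x , y) ∈Γ Γ → ¬ Lt (qpar q) a x) →
        (∀ x y → (x , y) ∈Γ Γ → ¬ Lt (qpar q) b y) →
        (pol q a ≡ pos → ∀ ja y → dpar q a ≡ just ja → (ja , y) ∈Γ Γ →
           dpar q b ≡ just y) →
        -- (c)
        (pol q a ≡ pos → ∀ ja → dpar q a ≡ just ja → (∀ y → ¬ (ja , y) ∈Γ Γ) →
           ∃ λ jb → dpar q b ≡ just jb × (∀ x → ¬ (x , jb) ∈Γ Γ) × φ ja ≡ jb) →
        (pol q a ≡ pos →
           (∀ a' → Imm (qpar q) a a' →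
              ∃ λ b' → Imm (qpar q) b b' × Bisim φ ((a' , b') ∷ Γ) a' b') ×
           (∀ b' → Imm (qpar q) b b' →
              ∃ λ a' → Imm (qpar q) a a' × Bisim φ ((a' , b') ∷ Γ) a' b')) →
        (pol q a ≡ neg →
           (∀ a' → Imm (qpar q) a a' →
              ∃ λ b' → Imm (qpar q) b b' × Bisim φ Γ a' b') ×
           (∀ b' → Imm (qpar q) b b' →
              ∃ λ a' → Imm (qpar q) a a' × Bisim φ Γ a' b')) →
        Bisim φ Γ a b

    _≈_ : Fin (nev q) → Fin (nev q) → Set
    a ≈ b = ∃ λ Γ → IsContext Γ × PreservesPointers Γ × Bisim (λ x → x) Γ a b

    CloneClassPos : Subset (nev q) → Set
    CloneClassPos Y = ∃ λ y → pol q y ≡ pos × (∀ x → (x ∈ Y → x ≈ y) × (x ≈ y → x ∈ Y))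

-- Every positive event has a unique ≺-predecessor, which is negative, and by determinism a negative
-- event has at most one positive successor; so ♯Y is the number of negative events with a successor
-- in Y. These events form a union of forks: if a ≺ b ∈ Y and a' is in the fork of a, then a and a'
-- lie over the same event of p by −-linearity, +-obsessionality yields a' ≺ b' over the same event
-- as b, and the bisimulation witnessing b ≈ y transplants from the subtree of a to that of a'
-- (successors are matched through the expansion map), so b' ≈ y. Hence ♯Y is the sum of the sizes
-- 2^i of the distinct forks meeting Y, and uniqueness of binary expansions identifies these i with I.

module Submission where

open import Defs
open import Data.Nat using (ℕ; _^_)
open import Data.List using (List; map)
open import Data.Nat.ListAction using (sum)
open import Data.List.Relation.Unary.Unique.Propositional using (Unique)
open import Data.List.Membership.Propositional using () renaming (_∈_ to _∈ₗ_)
open import Data.Product using (∃; _×_)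
open import Function.Bundles using (_⇔_; mk⇔; Equivalence)
open import Relation.Binary.PropositionalEquality using (_≡_)

open import Data.Bool using (if_then_else_)
open import Data.Empty using (⊥-elim)
open import Data.Fin as Fin using (Fin; toℕ; fromℕ<)
import Data.Fin.Properties as Finₚ
open import Data.Fin.Properties using (_≟_; toℕ-injective; toℕ<n; toℕ-fromℕ<; injective⇒≤; any?)
open import Data.Fin.Subset using (inside; outside; _⊆_)
open import Data.Fin.Subset.Properties using (_∈?_; ⊆-antisym)
open import Data.List using (_∷_; []; _++_; filter; allFin)
open import Data.List.Membership.Propositional using (find; lose)
open import Data.List.Membership.Propositional.Properties
  using (∈-++⁺ˡ; ∈-++⁺ʳ; ∈-++⁻; ∈-filter⁺; ∈-filter⁻; ∈-map⁺; ∈-map⁻; ∈-allFin)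
import Data.List.Membership.DecPropositional as DecMembership
open import Data.List.Relation.Unary.All as All using (All; []; _∷_)
open import Data.List.Relation.Unary.AllPairs using ([]; _∷_)
open import Data.List.Relation.Unary.Any as Any using (Any; here; there)
open import Data.Maybe using (Maybe; just; nothing; _>>=_)
import Data.Maybe.Properties as Maybe
open import Data.Maybe.Properties using (just-injective)
open import Data.Nat using (zero; suc; _+_; _*_; _∸_; _≤_; _<_; z≤n; s≤s; s≤s⁻¹)
open import Data.Nat.Properties
  using (<-cmp; ≤-total; ≤-reflexive; <⇒≤; <⇒≢; <-≤-trans; n<1+n; m<m+n; m<n⇒0<n∸m; m+[n∸m]≡n;
         +-comm; +-identityʳ; suc-injective; *-cancelˡ-≡; m^n>0; ^-monoʳ-<; even≢odd;
         +-0-commutativeMonoid)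
open import Data.Nat.Tactic.RingSolver using (solve-∀)
open import Algebra.Properties.CommutativeMonoid.Sum +-0-commutativeMonoid
  using (sum-syntax; sum-cong-≗; sum-replicate-zero; ∑-comm; ∑-distrib-+)
open import Data.Product using (_,_; proj₁; proj₂)
import Data.Product.Properties as Product
open import Data.Sum using (_⊎_; inj₁; inj₂)
import Data.Sum as Sum
open import Data.Vec using (_∷_; []; tabulate)
open import Data.Vec.Properties using (lookup∘tabulate; lookup⇒[]=; []=⇒lookup)
open import Function.Properties.Equivalence using () renaming (trans to ⇔-trans)
open import Relation.Binary.Construct.Closure.ReflexiveTransitive using (ε; _◅_; _◅◅_; gmap)
open import Relation.Binary.Definitions using (DecidableEquality; tri<; tri≈; tri>)
open import Relation.Binary.PropositionalEquality
  using (_≢_; refl; sym; trans; cong; subst; module ≡-Reasoning)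
open import Relation.Nullary using (¬_; Dec; yes; no; ¬?; does)
open import Relation.Nullary.Decidable using (_×-dec_; _⊎-dec_)
import Relation.Nullary.Decidable as Dec

nothing≢just : ∀ {A : Set} {x : A} → nothing ≢ just x
nothing≢just ()

module Forest {n : ℕ} (par : Fin n → Maybe (Fin n)) (acyclic : Acyclic par)
              (irreflexive : ∀ x → par x ≢ just x) where

  infix 4 _⋖_ _⊑_ _⊏_ _⊑?_

  _⋖_ _⊑_ _⊏_ : Fin n → Fin n → Set
  _⋖_ = Imm par
  _⊑_ = Le par
  _⊏_ = Lt par

  climb : ℕ → Maybe (Fin n) → Maybe (Fin n)
  climb zero    m = m
  climb (suc k) m = climb k (m >>= par)

  climb-nothing : ∀ k → climb k nothing ≡ nothing
  climb-nothing zero    = refl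
  climb-nothing (suc k) = climb-nothing k

  climb-+ : ∀ k d m → climb (k + d) m ≡ climb d (climb k m)
  climb-+ zero    d m = refl
  climb-+ (suc k) d m = climb-+ k d (m >>= par)

  climb-∸ : ∀ {k m} → k ≤ m → ∀ w → climb m w ≡ climb (m ∸ k) (climb k w)
  climb-∸ {k} {m} k≤m w =
    trans (cong (λ t → climb t w) (sym (m+[n∸m]≡n k≤m))) (climb-+ k (m ∸ k) w)

  climb⇒⊑ : ∀ k {u v} → climb k (just v) ≡ just u → u ⊑ v
  climb⇒⊑ zero    refl = ε
  climb⇒⊑ (suc k) {v = v} eq with par v in pv
  ... | nothing = ⊥-elim (nothing≢just (trans (sym (climb-nothing k)) eq))
  ... | just w  = climb⇒⊑ k eq ◅◅ (pv ◅ ε)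

  ⊑⇒climb : ∀ {u v} → u ⊑ v → ∃ λ k → climb k (just v) ≡ just u
  ⊑⇒climb ε = 0 , refl
  ⊑⇒climb {v = v} (u⋖w ◅ w⊑v) with ⊑⇒climb w⊑v
  ... | k , e = k + 1 , trans (climb-+ k 1 (just v)) (trans (cong (climb 1) e) u⋖w)

  ⊏⇒⊑ : ∀ {x y} → x ⊏ y → x ⊑ y
  ⊏⇒⊑ (_ , x⋖c , c⊑y) = x⋖c ◅ c⊑y

  ⊑-⊏-trans : ∀ {x y z} → x ⊑ y → y ⊏ z → x ⊏ z
  ⊑-⊏-trans ε           y⊏z = y⊏z
  ⊑-⊏-trans (x⋖w ◅ w⊑y) y⊏z = _ , x⋖w , ⊏⇒⊑ (⊑-⊏-trans w⊑y y⊏z)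

  ⋖-⊏-trans : ∀ {x y z} → x ⋖ y → y ⊏ z → x ⊏ z
  ⋖-⊏-trans x⋖y y⊏z = _ , x⋖y , ⊏⇒⊑ y⊏z

  ⊏-irrefl : ∀ {x} → ¬ x ⊏ x
  ⊏-irrefl {x} (c , x⋖c , c⊑x) =
    irreflexive x (subst (λ t → par t ≡ just x) (acyclic c x c⊑x (x⋖c ◅ ε)) x⋖c)

  ⊏⇒⋣ : ∀ {x y} → x ⊏ y → ¬ y ⊑ x
  ⊏⇒⋣ x⊏y y⊑x = ⊏-irrefl (⊑-⊏-trans y⊑x x⊏y)

  ⋖⇒⋣ : ∀ {c x} → c ⋖ x → ¬ x ⊑ c
  ⋖⇒⋣ c⋖x x⊑c = ⊏-irrefl (_ , c⋖x , x⊑c)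

  climb-acyclic : ∀ d {w} → 0 < d → climb d (just w) ≢ just w
  climb-acyclic (suc e) {w} _ eq with par w in pw
  ... | nothing = nothing≢just (trans (sym (climb-nothing e)) eq)
  ... | just w₁ = ⊏-irrefl (w , pw , climb⇒⊑ e eq)

  climb-from : ∀ {k m x u v} → k ≤ m → climb k (just x) ≡ just u → climb m (just x) ≡ just v →
               climb (m ∸ k) (just u) ≡ just v
  climb-from {k} {m} k≤m eᵤ eᵥ = trans (cong (climb (m ∸ k)) (sym eᵤ)) (trans (sym (climb-∸ k≤m _)) eᵥ)

  climb-<-≢ : ∀ {i j v w} → i < j → climb i (just v) ≡ just w → climb j (just v) ≢ just w
  climb-<-≢ {i} {j} i<j eᵢ eⱼ = climb-acyclic (j ∸ i) (m<n⇒0<n∸m i<j) (climb-from (<⇒≤ i<j) eᵢ eⱼ)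

  climb-injective : ∀ {v w} i j → climb i (just v) ≡ just w → climb j (just v) ≡ just w → i ≡ j
  climb-injective i j eᵢ eⱼ with <-cmp i j
  ... | tri< i<j _ _ = ⊥-elim (climb-<-≢ i<j eᵢ eⱼ)
  ... | tri≈ _ i≡j _ = i≡j
  ... | tri> _ _ j<i = ⊥-elim (climb-<-≢ j<i eⱼ eᵢ)

  climb-defined : ∀ {k u v} i → i ≤ k → climb k (just v) ≡ just u → ∃ λ w → climb i (just v) ≡ just w
  climb-defined {k} {v = v} i i≤k eq with climb i (just v) in eᵢ
  ... | just w  = w , refl
  ... | nothing = ⊥-elim (nothing≢just (begin
    nothing                         ≡⟨ climb-nothing (k ∸ i) ⟨
    climb (k ∸ i) nothing           ≡⟨ cong (climb (k ∸ i)) eᵢ ⟨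
    climb (k ∸ i) (climb i (just v)) ≡⟨ climb-∸ i≤k _ ⟨
    climb k (just v)                ≡⟨ eq ⟩
    just _                          ∎))
    where open ≡-Reasoning

  climb-bound : ∀ k {u v} → climb k (just v) ≡ just u → k < n
  climb-bound k eq = injective⇒≤ {f = ancestorAt} ancestorAt-injective
    where
    ancestorAt-defined : ∀ (i : Fin (suc k)) → ∃ λ w → climb (toℕ i) (just _) ≡ just w
    ancestorAt-defined i = climb-defined (toℕ i) (s≤s⁻¹ (toℕ<n i)) eq
    ancestorAt : Fin (suc k) → Fin n
    ancestorAt i = proj₁ (ancestorAt-defined i)
    ancestorAt-injective : ∀ {i j} → ancestorAt i ≡ ancestorAt j → i ≡ j
    ancestorAt-injective {i} {j} e = toℕ-injective (climb-injective (toℕ i) (toℕ j)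
      (proj₂ (ancestorAt-defined i)) (trans (proj₂ (ancestorAt-defined j)) (cong just (sym e))))

  _⊑?_ : ∀ u v → Dec (u ⊑ v)
  u ⊑? v = Dec.map′ (λ (k , e) → climb⇒⊑ (toℕ k) e) shortClimb
             (any? λ (k : Fin n) → Maybe.≡-dec _≟_ (climb (toℕ k) (just v)) (just u))
    where
    shortClimb : u ⊑ v → ∃ λ (k : Fin n) → climb (toℕ k) (just v) ≡ just u
    shortClimb u⊑v with ⊑⇒climb u⊑v
    ... | k , e = fromℕ< k<n , subst (λ t → climb t (just v) ≡ just u) (sym (toℕ-fromℕ< k<n)) e
      where k<n = climb-bound k e

  ⊑-comparable : ∀ {u v x} → u ⊑ x → v ⊑ x → u ⊑ v ⊎ v ⊑ u
  ⊑-comparable u⊑x v⊑x with ⊑⇒climb u⊑x | ⊑⇒climb v⊑x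
  ... | k , eᵤ | m , eᵥ with ≤-total k m
  ... | inj₁ k≤m = inj₂ (climb⇒⊑ (m ∸ k) (climb-from k≤m eᵤ eᵥ))
  ... | inj₂ m≤k = inj₁ (climb⇒⊑ (k ∸ m) (climb-from m≤k eᵥ eᵤ))

  ⊑-parent : ∀ {u c z} → u ⊑ c → z ⋖ c → u ≡ c ⊎ u ⊑ z
  ⊑-parent u⊑c z⋖c with ⊑⇒climb u⊑c
  ... | zero  , refl = inj₁ refl
  ... | suc k , e    = inj₂ (climb⇒⊑ k (trans (cong (climb k) (sym z⋖c)) e))

  ⊑-root : ∀ {u r} → par r ≡ nothing → u ⊑ r → u ≡ r
  ⊑-root r-root u⊑r with ⊑⇒climb u⊑r
  ... | zero  , refl = refl
  ... | suc k , e    = ⊥-elim (nothing≢just (trans (sym (climb-nothing k))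
                         (trans (cong (climb k) (sym r-root)) e)))

  ancestor-split : ∀ {c a j x} → c ⋖ a → j ⊑ x → a ⊑ x → a ⊑ j ⊎ j ⊑ c
  ancestor-split c⋖a j⊑x a⊑x with ⊑-comparable j⊑x a⊑x
  ... | inj₂ a⊑j = inj₁ a⊑j
  ... | inj₁ j⊑a with ⊑-parent j⊑a c⋖a
  ...   | inj₁ refl = inj₁ ε
  ...   | inj₂ j⊑c  = inj₂ j⊑c

pos≢neg : pos ≢ neg
pos≢neg ()

≢pos⇒neg : ∀ {x} → x ≢ pos → x ≡ neg
≢pos⇒neg {pos} x≢pos = ⊥-elim (x≢pos refl)
≢pos⇒neg {neg} _     = refl

≢neg⇒pos : ∀ {x} → x ≢ neg → x ≡ pos
≢neg⇒pos {pos} _     = refl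
≢neg⇒pos {neg} x≢neg = ⊥-elim (x≢neg refl)

same-pol : ∀ {x y} → x ≡ y → x ≡ pos ⊎ y ≡ neg
same-pol {pos} _    = inj₁ refl
same-pol {neg} refl = inj₂ refl

_≟ₚ_ : (x y : Pol) → Dec (x ≡ y)
pos ≟ₚ pos = yes refl
neg ≟ₚ neg = yes refl
pos ≟ₚ neg = no λ ()
neg ≟ₚ pos = no λ ()

module AugmentationProperties {A : Arena} (q : Augmentation A) where

  dpar-alternates : ∀ {j x} → dpar q x ≡ just j → pol q j ≢ pol q x
  dpar-alternates {j} {x} e = alternating A (disp q x) (disp q j) (dispSucc q x j e)

  qpar-alternates : ∀ {c x} → qpar q x ≡ just c → pol q c ≢ pol q x
  qpar-alternates c⋖x same = dpar-alternates (courteous q _ _ c⋖x (same-pol same)) same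

  open Forest (qpar q) (qAcyclic q) (λ x loop → qpar-alternates loop refl) public

  pos⇒parent-neg : ∀ {c x} → c ⋖ x → pol q x ≡ pos → pol q c ≡ neg
  pos⇒parent-neg c⋖x px = ≢pos⇒neg λ pc → qpar-alternates c⋖x (trans pc (sym px))

  pos⇒child-neg : ∀ {c x} → c ⋖ x → pol q c ≡ pos → pol q x ≡ neg
  pos⇒child-neg c⋖x pc = ≢pos⇒neg λ px → qpar-alternates c⋖x (trans pc (sym px))

  neg⇒child-pos : ∀ {c x} → c ⋖ x → pol q c ≡ neg → pol q x ≡ pos
  neg⇒child-pos c⋖x nc = ≢neg⇒pos λ nx → qpar-alternates c⋖x (trans nc (sym nx))

  neg⇒justified-by-parent : ∀ {c x} → c ⋖ x → pol q x ≡ neg → dpar q x ≡ just c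
  neg⇒justified-by-parent c⋖x nx = courteous q _ _ c⋖x (inj₂ nx)

  pos⇒justified : ∀ {x} → pol q x ≡ pos → ∃ λ j → dpar q x ≡ just j
  pos⇒justified {x} px with dpar q x in dx
  ... | just j  = j , refl
  ... | nothing = ⊥-elim (pos≢neg (trans (sym px) (minNegA A (disp q x) (dispMin q x dx))))

  justifier-⊑ : ∀ {j x} → dpar q x ≡ just j → j ⊑ x
  justifier-⊑ {j} {x} e = ruleAbiding q j x (e ◅ ε)

  pos⇒justifier-neg : ∀ {j x} → dpar q x ≡ just j → pol q x ≡ pos → pol q j ≡ neg
  pos⇒justifier-neg e px = ≢pos⇒neg λ pj → dpar-alternates e (trans pj (sym px))

  pos⇒has-parent : ∀ {x} → pol q x ≡ pos → ∃ λ c → c ⋖ x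
  pos⇒has-parent {x} px with qpar q x in qx | pos⇒justified px
  ... | just c  | _      = c , refl
  ... | nothing | j , dj = ⊥-elim (dpar-alternates dj (cong (pol q) (⊑-root qx (justifier-⊑ dj))))

module PairLists {X : Set} (_≟ₓ_ : DecidableEquality X) where

  dom? : ∀ u (Γ : List (X × X)) → Dec (∃ λ w → (u , w) ∈ₗ Γ)
  dom? u Γ = Dec.map′ found (λ (w , m) → lose m refl) (Any.any? (λ e → proj₁ e ≟ₓ u) Γ)
    where
    found : Any (λ e → proj₁ e ≡ u) Γ → ∃ λ w → (u , w) ∈ₗ Γ
    found any with find any
    ... | (_ , w) , m , refl = w , m

  cod? : ∀ w (Γ : List (X × X)) → Dec (∃ λ u → (u , w) ∈ₗ Γ)
  cod? w Γ = Dec.map′ found (λ (u , m) → lose m refl) (Any.any? (λ e → proj₂ e ≟ₓ w) Γ)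
    where
    found : Any (λ e → proj₂ e ≡ w) Γ → ∃ λ u → (u , w) ∈ₗ Γ
    found any with find any
    ... | (u , _) , m , refl = u , m

module ExpansionProperties {A : Arena} {p q : Augmentation A}
         (p-negLinear : NegLinear p) (q-negObsessional : NegObsessional q) (exp : Expansion q p) where

  open AugmentationProperties q
  open PairLists (_≟_ {nev q})
  open DecMembership (Product.≡-dec (_≟_ {nev q}) (_≟_ {nev q})) using () renaming (_∈?_ to _∈ₗ?_)
  private module P = AugmentationProperties p

  private
    morphism : Morphism q p
    morphism = proj₁ exp

  f : Fin (nev q) → Fin (nev p)
  f = fun morphism

  f-disp : ∀ {x y} → f x ≡ f y → disp q x ≡ disp q y
  f-disp {x} {y} e = trans (sym (presDisp morphism x)) (trans (cong (disp p) e) (presDisp morphism y))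

  f-pol : ∀ {x y} → f x ≡ f y → pol q x ≡ pol q y
  f-pol e = cong (polA A) (f-disp e)

  f-⋖ : ∀ {c x} → c ⋖ x → f c P.⋖ f x
  f-⋖ = presQ morphism _ _

  f-⊑ : ∀ {u v} → u ⊑ v → f u P.⊑ f v
  f-⊑ = gmap f f-⋖

  f-justifier : ∀ {x x' j j'} → dpar q x ≡ just j → dpar q x' ≡ just j' → f x ≡ f x' → f j ≡ f j'
  f-justifier {x} {x'} {j} {j'} dj dj' e = just-injective (begin
    just (f j)     ≡⟨ presD morphism j x dj ⟨
    dpar p (f x)   ≡⟨ cong (dpar p) e ⟩
    dpar p (f x')  ≡⟨ presD morphism j' x' dj' ⟩
    just (f j')    ∎)
    where open ≡-Reasoning

  f-injective-on-chains : ∀ {u v} → u ⊑ v → f u ≡ f v → u ≡ v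
  f-injective-on-chains ε           _     = refl
  f-injective-on-chains (u⋖w ◅ w⊑v) fu≡fv =
    ⊥-elim (P.⋖⇒⋣ (f-⋖ u⋖w) (subst (f _ P.⊑_) (sym fu≡fv) (f-⊑ w⊑v)))

  f-injective-on-ancestors : ∀ {k j x} → k ⊑ x → j ⊑ x → f k ≡ f j → k ≡ j
  f-injective-on-ancestors k⊑x j⊑x e with ⊑-comparable k⊑x j⊑x
  ... | inj₁ k⊑j = f-injective-on-chains k⊑j e
  ... | inj₂ j⊑k = sym (f-injective-on-chains j⊑k (sym e))

  pol-f : ∀ x → pol p (f x) ≡ pol q x
  pol-f x = cong (polA A) (presDisp morphism x)

  match-neg-child : ∀ {x x' a'} → pol q x ≡ pos → f x' ≡ f x → x' ⋖ a' → ∃ λ a → x ⋖ a × f a ≡ f a'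
  match-neg-child {x} {x'} {a'} px e x'⋖a' =
    let a , x⋖a , da = q-negObsessional x (disp q a') px disp-a'-parent na'
    in  a , x⋖a , p-negLinear (f x) (f a) (f a') (f-⋖ x⋖a) (subst (P._⋖ f a') e (f-⋖ x'⋖a'))
                    (trans (pol-f a) (pos⇒child-neg x⋖a px)) (trans (pol-f a') na')
                    (trans (presDisp morphism a) (trans da (sym (presDisp morphism a'))))
    where
    px' : pol q x' ≡ pos
    px' = trans (f-pol e) px
    na' : pol q a' ≡ neg
    na' = pos⇒child-neg x'⋖a' px'
    disp-a'-parent : parA A (disp q a') ≡ just (disp q x)
    disp-a'-parent = trans (dispSucc q a' x' (courteous q x' a' x'⋖a' (inj₁ px'))) (cong just (f-disp e))

  match-pos-child : ∀ {x x' a'} → f x' ≡ f x → x' ⋖ a' → pol q a' ≡ pos → ∃ λ a → x ⋖ a × f a ≡ f a'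
  match-pos-child {x} {x'} {a'} e x'⋖a' pa' =
    proj₂ exp x (f a') (trans (pol-f a') pa') (subst (P._⋖ f a') e (f-⋖ x'⋖a'))

  Clone : Ctx q → Fin (nev q) → Fin (nev q) → Set
  Clone = Bisim q (λ x → x)

  clone-cod-not-after : ∀ {Γ x z} → Clone Γ x z → ∀ u w → (u , w) ∈ₗ Γ → ¬ z ⊏ w
  clone-cod-not-after (bisim _ _ cod-ok _ _ _ _) = cod-ok

  MappedPointers : Ctx q → Fin (nev q) → Fin (nev q) → Set
  MappedPointers Γ x z = pol q x ≡ pos → ∀ j w → dpar q x ≡ just j → (j , w) ∈ₗ Γ → dpar q z ≡ just w

  FreePointers : Ctx q → Fin (nev q) → Fin (nev q) → Set
  FreePointers Γ x z = pol q x ≡ pos → ∀ j → dpar q x ≡ just j → (∀ w → ¬ (j , w) ∈ₗ Γ) →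
                       ∃ λ jz → dpar q z ≡ just jz × (∀ v → ¬ (v , jz) ∈ₗ Γ) × j ≡ jz

  Free : Ctx q → Fin (nev q) → Set
  Free Γ j = (∀ w → ¬ (j , w) ∈ₗ Γ) × (∀ v → ¬ (v , j) ∈ₗ Γ)

  free? : ∀ Γ j → Dec (Free Γ j)
  free? Γ j = Dec.map′ (λ (nd , nc) → (λ w m → nd (w , m)) , (λ v m → nc (v , m)))
                       (λ (nd , nc) → (λ (w , m) → nd w m) , (λ (v , m) → nc v m))
                       (¬? (dom? j Γ) ×-dec ¬? (cod? j Γ))

  module SiblingTransport {a a' c : Fin (nev q)} (c⋖a : c ⋖ a) (c⋖a' : c ⋖ a') where

    record Correspondence (Δ : Ctx q) (x' x : Fin (nev q)) : Set where
      field
        image    : f x' ≡ f x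
        a'⊑x'    : a' ⊑ x'
        a⊑x      : a ⊑ x
        sound    : ∀ {u' u} → (u' , u) ∈ₗ Δ → u ⊑ x × f u' ≡ f u
        complete : ∀ {u'} → a' ⊑ u' → u' ⊑ x' → ∃ λ u → (u' , u) ∈ₗ Δ

    correspondence-start : f a' ≡ f a → Correspondence ((a' , a) ∷ []) a' a
    correspondence-start e = record
      { image    = e
      ; a'⊑x'    = ε
      ; a⊑x      = ε
      ; sound    = λ { (here refl) → ε , e }
      ; complete = λ a'⊑u' u'⊑a' → a , here (cong (_, a) (qAcyclic q _ _ u'⊑a' a'⊑u'))
      }

    correspondence-step : ∀ {Δ x' x a₁' a₁} → Correspondence Δ x' x → x' ⋖ a₁' → x ⋖ a₁ →
                          f a₁' ≡ f a₁ → Correspondence ((a₁' , a₁) ∷ Δ) a₁' a₁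
    correspondence-step {Δ} {x'} {x} {a₁'} {a₁} C x'⋖a₁' x⋖a₁ e = record
      { image    = e
      ; a'⊑x'    = a'⊑x' ◅◅ (x'⋖a₁' ◅ ε)
      ; a⊑x      = a⊑x ◅◅ (x⋖a₁ ◅ ε)
      ; sound    = sound'
      ; complete = complete'
      }
      where
      open Correspondence C
      sound' : ∀ {u' u} → (u' , u) ∈ₗ (a₁' , a₁) ∷ Δ → u ⊑ a₁ × f u' ≡ f u
      sound' (here refl) = ε , e
      sound' (there m)   = let u⊑x , fe = sound m in u⊑x ◅◅ (x⋖a₁ ◅ ε) , fe
      complete' : ∀ {u'} → a' ⊑ u' → u' ⊑ a₁' → ∃ λ u → (u' , u) ∈ₗ (a₁' , a₁) ∷ Δ
      complete' a'⊑u' u'⊑a₁' with ⊑-parent u'⊑a₁' x'⋖a₁'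
      ... | inj₁ refl  = a₁ , here refl
      ... | inj₂ u'⊑x' = let u , m = complete a'⊑u' u'⊑x' in u , there m

    justifier-transport : ∀ {Δ x' x j'} → Correspondence Δ x' x → pol q x' ≡ pos → dpar q x' ≡ just j' →
      (∃ λ j → (j' , j) ∈ₗ Δ × dpar q x ≡ just j) ⊎ (j' ⊑ c × dpar q x ≡ just j')
    justifier-transport {Δ} {x'} {x} {j'} C px' dj' =
      Sum.map in-subtree above-c (ancestor-split c⋖a' (justifier-⊑ dj') a'⊑x')
      where
      open Correspondence C
      dk = proj₂ (pos⇒justified (trans (sym (f-pol image)) px'))
      justifier-is : ∀ {j} → j ⊑ x → f j' ≡ f j → dpar q x ≡ just j
      justifier-is j⊑x e = trans dk (cong just
        (f-injective-on-ancestors (justifier-⊑ dk) j⊑x (trans (f-justifier dk dj' (sym image)) e)))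
      in-subtree : a' ⊑ j' → ∃ λ j → (j' , j) ∈ₗ Δ × dpar q x ≡ just j
      in-subtree a'⊑j' = let j , m = complete a'⊑j' (justifier-⊑ dj') ; j⊑x , fe = sound m
                         in  j , m , justifier-is j⊑x fe
      above-c : j' ⊑ c → j' ⊑ c × dpar q x ≡ just j'
      above-c j'⊑c = j'⊑c , justifier-is (j'⊑c ◅◅ (c⋖a ◅ a⊑x)) refl

    -- x' ∼Γ' z is obtained from x ∼Γ z by transplanting the left-hand side from the subtree of a
    -- to that of its sibling a': Δ matches the branch a' … x' with the branch a … x, and Γ' moves
    -- the left components of Γ along Δ while leaving those above c untouched.
    record Invariant (Γ Γ' Δ : Ctx q) (x' x z : Fin (nev q)) : Set where
      field
        path               : Correspondence Δ x' x
        Γ'-functional      : ∀ {u w w'} → (u , w) ∈ₗ Γ' → (u , w') ∈ₗ Γ' → w ≡ w'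
        same-on-ancestors⁺ : ∀ {j w} → j ⊑ c → (j , w) ∈ₗ Γ → (j , w) ∈ₗ Γ'
        same-on-ancestors⁻ : ∀ {j w} → j ⊑ c → (j , w) ∈ₗ Γ' → (j , w) ∈ₗ Γ
        cod-old            : ∀ {u w} → (u , w) ∈ₗ Γ' → (∃ λ v → (v , w) ∈ₗ Γ) ⊎ w ≡ a
        along-path         : ∀ {j' j w} → (j' , j) ∈ₗ Δ → (j , w) ∈ₗ Γ → (j' , w) ∈ₗ Γ'
        along-path-free    : ∀ {j' j} → (j' , j) ∈ₗ Δ → pol q j ≡ neg → Free Γ j → j ⊑ z → (j' , j) ∈ₗ Γ'
        dom-not-after      : ∀ {u w} → (u , w) ∈ₗ Γ' → ¬ x' ⊏ u
        cod-not-after      : ∀ {u w} → (u , w) ∈ₗ Γ' → ¬ z ⊏ w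
      open Correspondence path public

    DomNotAfter : Ctx q → Fin (nev q) → Set
    DomNotAfter Γ x = ∀ u w → (u , w) ∈ₗ Γ → ¬ x ⊏ u

    invariant-step-pos : ∀ {Γ Γ' Δ x' x z a₁' a₁ c₁} → Invariant Γ Γ' Δ x' x z → DomNotAfter Γ x →
      x' ⋖ a₁' → x ⋖ a₁ → z ⋖ c₁ → f a₁' ≡ f a₁ →
      Invariant ((a₁ , c₁) ∷ Γ) ((a₁' , c₁) ∷ Γ') ((a₁' , a₁) ∷ Δ) a₁' a₁ c₁
    invariant-step-pos {Γ} {Γ'} {Δ} {x'} {x} {z} {a₁'} {a₁} {c₁} I dom-ok x'⋖a₁' x⋖a₁ z⋖c₁ e = record
      { path               = correspondence-step path x'⋖a₁' x⋖a₁ e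
      ; Γ'-functional      = Γₙ'-functional
      ; same-on-ancestors⁺ = ancestors⁺
      ; same-on-ancestors⁻ = ancestors⁻
      ; cod-old            = cod-old'
      ; along-path         = along-path'
      ; along-path-free    = along-path-free'
      ; dom-not-after      = dom-not-after'
      ; cod-not-after      = cod-not-after'
      }
      where
      open Invariant I
      Γₙ  = (a₁ , c₁) ∷ Γ
      Γₙ' = (a₁' , c₁) ∷ Γ'
      Γₙ'-functional : ∀ {u w w'} → (u , w) ∈ₗ Γₙ' → (u , w') ∈ₗ Γₙ' → w ≡ w'
      Γₙ'-functional (here refl) (here refl) = refl
      Γₙ'-functional (here refl) (there m)   = ⊥-elim (dom-not-after m (_ , x'⋖a₁' , ε))
      Γₙ'-functional (there m)   (here refl) = ⊥-elim (dom-not-after m (_ , x'⋖a₁' , ε))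
      Γₙ'-functional (there m)   (there m')  = Γ'-functional m m'
      ancestors⁺ : ∀ {j w} → j ⊑ c → (j , w) ∈ₗ Γₙ → (j , w) ∈ₗ Γₙ'
      ancestors⁺ a₁⊑c (here refl) = ⊥-elim (⋖⇒⋣ c⋖a (a⊑x ◅◅ (x⋖a₁ ◅ a₁⊑c)))
      ancestors⁺ j⊑c  (there m)   = there (same-on-ancestors⁺ j⊑c m)
      ancestors⁻ : ∀ {j w} → j ⊑ c → (j , w) ∈ₗ Γₙ' → (j , w) ∈ₗ Γₙ
      ancestors⁻ a₁'⊑c (here refl) = ⊥-elim (⋖⇒⋣ c⋖a' (a'⊑x' ◅◅ (x'⋖a₁' ◅ a₁'⊑c)))
      ancestors⁻ j⊑c   (there m)   = there (same-on-ancestors⁻ j⊑c m)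
      cod-old' : ∀ {u w} → (u , w) ∈ₗ Γₙ' → (∃ λ v → (v , w) ∈ₗ Γₙ) ⊎ w ≡ a
      cod-old' (here refl) = inj₁ (a₁ , here refl)
      cod-old' (there m)   = Sum.map₁ (λ (v , m') → v , there m') (cod-old m)
      along-path' : ∀ {j' j w} → (j' , j) ∈ₗ (a₁' , a₁) ∷ Δ → (j , w) ∈ₗ Γₙ → (j' , w) ∈ₗ Γₙ'
      along-path' (here refl) (here refl) = here refl
      along-path' (here refl) (there m)   = ⊥-elim (dom-ok _ _ m (_ , x⋖a₁ , ε))
      along-path' (there jΔ)  (here refl) = ⊥-elim (⋖⇒⋣ x⋖a₁ (proj₁ (sound jΔ)))
      along-path' (there jΔ)  (there m)   = there (along-path jΔ m)
      along-path-free' : ∀ {j' j} → (j' , j) ∈ₗ (a₁' , a₁) ∷ Δ → pol q j ≡ neg → Free Γₙ j → j ⊑ c₁ →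
                         (j' , j) ∈ₗ Γₙ'
      along-path-free' (here refl) _  (nd , _)  _    = ⊥-elim (nd c₁ (here refl))
      along-path-free' (there jΔ)  nj (nd , nc) j⊑c₁ with ⊑-parent j⊑c₁ z⋖c₁
      ... | inj₁ refl = ⊥-elim (nc a₁ (here refl))
      ... | inj₂ j⊑z  =
        there (along-path-free jΔ nj ((λ w m → nd w (there m)) , (λ v m → nc v (there m))) j⊑z)
      dom-not-after' : ∀ {u w} → (u , w) ∈ₗ Γₙ' → ¬ a₁' ⊏ u
      dom-not-after' (here refl) = ⊏-irrefl
      dom-not-after' (there m)   = λ a₁'⊏u → dom-not-after m (⋖-⊏-trans x'⋖a₁' a₁'⊏u)
      cod-not-after' : ∀ {u w} → (u , w) ∈ₗ Γₙ' → ¬ c₁ ⊏ w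
      cod-not-after' (here refl) = ⊏-irrefl
      cod-not-after' (there m)   = λ c₁⊏w → cod-not-after m (⋖-⊏-trans z⋖c₁ c₁⊏w)

    invariant-step-neg : ∀ {Γ Γ' Δ x' x z a₁' a₁ c₁} → Invariant Γ Γ' Δ x' x z → DomNotAfter Γ x →
      x' ⋖ a₁' → x ⋖ a₁ → z ⋖ c₁ → f a₁' ≡ f a₁ → pol q a₁ ≡ pos → pol q c₁ ≡ pos →
      Invariant Γ Γ' ((a₁' , a₁) ∷ Δ) a₁' a₁ c₁
    invariant-step-neg {Γ} {Γ'} {Δ} {x'} {x} {z} {a₁'} {a₁} {c₁} I dom-ok x'⋖a₁' x⋖a₁ z⋖c₁ e pa₁ pc₁ =
      record
      { path               = correspondence-step path x'⋖a₁' x⋖a₁ e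
      ; Γ'-functional      = Γ'-functional
      ; same-on-ancestors⁺ = same-on-ancestors⁺
      ; same-on-ancestors⁻ = same-on-ancestors⁻
      ; cod-old            = cod-old
      ; along-path         = along-path'
      ; along-path-free    = along-path-free'
      ; dom-not-after      = λ m a₁'⊏u → dom-not-after m (⋖-⊏-trans x'⋖a₁' a₁'⊏u)
      ; cod-not-after      = λ m c₁⊏w → cod-not-after m (⋖-⊏-trans z⋖c₁ c₁⊏w)
      }
      where
      open Invariant I
      along-path' : ∀ {j' j w} → (j' , j) ∈ₗ (a₁' , a₁) ∷ Δ → (j , w) ∈ₗ Γ → (j' , w) ∈ₗ Γ'
      along-path' (here refl) m = ⊥-elim (dom-ok _ _ m (_ , x⋖a₁ , ε))
      along-path' (there jΔ)  m = along-path jΔ m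
      along-path-free' : ∀ {j' j} → (j' , j) ∈ₗ (a₁' , a₁) ∷ Δ → pol q j ≡ neg → Free Γ j → j ⊑ c₁ →
                         (j' , j) ∈ₗ Γ'
      along-path-free' (here refl) nj _ _ = ⊥-elim (pos≢neg (trans (sym pa₁) nj))
      along-path-free' (there jΔ)  nj fr j⊑c₁ with ⊑-parent j⊑c₁ z⋖c₁
      ... | inj₁ refl = ⊥-elim (pos≢neg (trans (sym pc₁) nj))
      ... | inj₂ j⊑z  = along-path-free jΔ nj fr j⊑z

    module _ {Γ Γ' Δ x' x z} (I : Invariant Γ Γ' Δ x' x z)
             (mapped : MappedPointers Γ x z) (free : FreePointers Γ x z) where
      open Invariant I

      private
        pos-x : pol q x' ≡ pos → pol q x ≡ pos
        pos-x = trans (sym (f-pol image))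

        justifier-mapped : ∀ {j' j} → pol q x ≡ pos → (j' , j) ∈ₗ Δ → dpar q x ≡ just j →
                           ∃ λ w → (j' , w) ∈ₗ Γ' × dpar q z ≡ just w
        justifier-mapped {j = j} px jΔ dj with dom? j Γ
        ... | yes (w , m) = w , along-path jΔ m , mapped px j w dj m
        ... | no j∉dom with free px j dj (λ w m → j∉dom (w , m))
        ...   | _ , dz , j∉cod , refl =
                j , along-path-free jΔ (pos⇒justifier-neg dj px) ((λ w m → j∉dom (w , m)) , j∉cod)
                                    (justifier-⊑ dz) ,
                dz

      transport-mapped : MappedPointers Γ' x' z
      transport-mapped px' j' w dj' m with justifier-transport path px' dj'
      ... | inj₁ (j , jΔ , dj) = let w₀ , m₀ , dz = justifier-mapped (pos-x px') jΔ dj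
                                 in  trans dz (cong just (Γ'-functional m₀ m))
      ... | inj₂ (j'⊑c , dj)   = mapped (pos-x px') j' w dj (same-on-ancestors⁻ j'⊑c m)

      transport-free : FreePointers Γ' x' z
      transport-free px' j' dj' j'∉dom with justifier-transport path px' dj'
      ... | inj₁ (j , jΔ , dj) = ⊥-elim (j'∉dom _ (proj₁ (proj₂ (justifier-mapped (pos-x px') jΔ dj))))
      ... | inj₂ (j'⊑c , dj) with free (pos-x px') j' dj (λ w m → j'∉dom w (same-on-ancestors⁺ j'⊑c m))
      ...   | _ , dz , j'∉cod , refl = j' , dz , j'∉cod' , refl
        where
        j'∉cod' : ∀ v → ¬ (v , j') ∈ₗ Γ'
        j'∉cod' v m with cod-old m
        ... | inj₁ (v₀ , m₀) = j'∉cod v₀ m₀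
        ... | inj₂ refl      = ⋖⇒⋣ c⋖a j'⊑c

    transport : ∀ {Γ x z} → Clone Γ x z → ∀ {Γ' Δ x'} → Invariant Γ Γ' Δ x' x z → Clone Γ' x' z
    transport {Γ} {x} {z} (bisim x≃z dom-ok _ mapped free pos-step neg-step) {Γ'} {Δ} {x'} I =
      bisim (trans (f-disp image) x≃z) (λ _ _ → dom-not-after) (λ _ _ → cod-not-after)
            (transport-mapped I mapped free) (transport-free I mapped free) pos-step' neg-step'
      where
      open Invariant I

      pos-step' : pol q x' ≡ pos →
        (∀ a₁' → x' ⋖ a₁' → ∃ λ c₁ → z ⋖ c₁ × Clone ((a₁' , c₁) ∷ Γ') a₁' c₁) ×
        (∀ c₁ → z ⋖ c₁ → ∃ λ a₁' → x' ⋖ a₁' × Clone ((a₁' , c₁) ∷ Γ') a₁' c₁)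
      pos-step' px' = forth , back
        where
        px = trans (sym (f-pol image)) px'
        forth : ∀ a₁' → x' ⋖ a₁' → ∃ λ c₁ → z ⋖ c₁ × Clone ((a₁' , c₁) ∷ Γ') a₁' c₁
        forth a₁' x'⋖a₁' with match-neg-child px image x'⋖a₁'
        ... | a₁ , x⋖a₁ , e with proj₁ (pos-step px) a₁ x⋖a₁
        ...   | c₁ , z⋖c₁ , a₁∼c₁ =
                c₁ , z⋖c₁ , transport a₁∼c₁ (invariant-step-pos I dom-ok x'⋖a₁' x⋖a₁ z⋖c₁ (sym e))
        back : ∀ c₁ → z ⋖ c₁ → ∃ λ a₁' → x' ⋖ a₁' × Clone ((a₁' , c₁) ∷ Γ') a₁' c₁
        back c₁ z⋖c₁ with proj₂ (pos-step px) c₁ z⋖c₁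
        ... | a₁ , x⋖a₁ , a₁∼c₁ with match-neg-child px' (sym image) x⋖a₁
        ...   | a₁' , x'⋖a₁' , e =
                a₁' , x'⋖a₁' , transport a₁∼c₁ (invariant-step-pos I dom-ok x'⋖a₁' x⋖a₁ z⋖c₁ e)

      neg-step' : pol q x' ≡ neg →
        (∀ a₁' → x' ⋖ a₁' → ∃ λ c₁ → z ⋖ c₁ × Clone Γ' a₁' c₁) ×
        (∀ c₁ → z ⋖ c₁ → ∃ λ a₁' → x' ⋖ a₁' × Clone Γ' a₁' c₁)
      neg-step' nx' = forth , back
        where
        nx = trans (sym (f-pol image)) nx'
        nz = trans (sym (cong (polA A) x≃z)) nx
        pos-a₁ : ∀ {a₁} → x ⋖ a₁ → pol q a₁ ≡ pos
        pos-a₁ x⋖a₁ = neg⇒child-pos x⋖a₁ nx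
        pos-c₁ : ∀ {c₁} → z ⋖ c₁ → pol q c₁ ≡ pos
        pos-c₁ z⋖c₁ = neg⇒child-pos z⋖c₁ nz
        forth : ∀ a₁' → x' ⋖ a₁' → ∃ λ c₁ → z ⋖ c₁ × Clone Γ' a₁' c₁
        forth a₁' x'⋖a₁' with match-pos-child image x'⋖a₁' (neg⇒child-pos x'⋖a₁' nx')
        ... | a₁ , x⋖a₁ , e with proj₁ (neg-step nx) a₁ x⋖a₁
        ...   | c₁ , z⋖c₁ , a₁∼c₁ = c₁ , z⋖c₁ , transport a₁∼c₁
                (invariant-step-neg I dom-ok x'⋖a₁' x⋖a₁ z⋖c₁ (sym e) (pos-a₁ x⋖a₁) (pos-c₁ z⋖c₁))
        back : ∀ c₁ → z ⋖ c₁ → ∃ λ a₁' → x' ⋖ a₁' × Clone Γ' a₁' c₁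
        back c₁ z⋖c₁ with proj₂ (neg-step nx) c₁ z⋖c₁
        ... | a₁ , x⋖a₁ , a₁∼c₁ with match-pos-child (sym image) x⋖a₁ (pos-a₁ x⋖a₁)
        ...   | a₁' , x'⋖a₁' , e = a₁' , x'⋖a₁' , transport a₁∼c₁
                (invariant-step-neg I dom-ok x'⋖a₁' x⋖a₁ z⋖c₁ e (pos-a₁ x⋖a₁) (pos-c₁ z⋖c₁))

    -- Γ₀ drops the pairs of Γ whose left component is a or lies below a', and sends a' wherever
    -- Γ sends a; if Γ does not mention a but a ⊑ y, it sends a' to a itself, as clause (c)
    -- with φ = id does for pointers to a.
    module Initial {Γ b b' y} (ctx : IsContext q Γ) (ptrs : PreservesPointers q Γ) (b∼y : Clone Γ b y)
                   (a⋖b : a ⋖ b) (a'⋖b' : a' ⋖ b') (fb : f b' ≡ f b) (pb : pol q b ≡ pos)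
                   (fa : f a' ≡ f a)
                   where
      open IsContext ctx

      na : pol q a ≡ neg
      na = pos⇒parent-neg a⋖b pb

      na' : pol q a' ≡ neg
      na' = trans (f-pol fa) na

      Target : Fin (nev q) → Set
      Target w = (a , w) ∈ₗ Γ ⊎ (w ≡ a × Free Γ a × a ⊑ y)

      target? : ∀ w → Dec (Target w)
      target? w = ((a , w) ∈ₗ? Γ) ⊎-dec ((w ≟ a) ×-dec (free? Γ a ×-dec (a ⊑? y)))

      target-unique : ∀ {w w'} → Target w → Target w' → w ≡ w'
      target-unique (inj₁ m)                     (inj₁ m')                     = functional _ _ _ m m'
      target-unique (inj₁ m)                     (inj₂ (_ , (a∉dom , _) , _)) = ⊥-elim (a∉dom _ m)
      target-unique (inj₂ (_ , (a∉dom , _) , _)) (inj₁ m')                     = ⊥-elim (a∉dom _ m')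
      target-unique (inj₂ (refl , _))            (inj₂ (refl , _))             = refl

      target-only-from-a : ∀ {u w} → Target w → (u , w) ∈ₗ Γ → u ≡ a
      target-only-from-a (inj₁ m)                        m' = injective _ _ _ m' m
      target-only-from-a (inj₂ (refl , (_ , a∉cod) , _)) m' = ⊥-elim (a∉cod _ m')

      target-neg : ∀ {w} → Target w → pol q w ≡ neg
      target-neg (inj₁ m)          = negCod _ _ m
      target-neg (inj₂ (refl , _)) = na

      target-disp : ∀ {w} → Target w → disp q a ≡ disp q w
      target-disp (inj₁ m)          = dispPres _ _ m
      target-disp (inj₂ (refl , _)) = refl

      target-ptr : ∀ {w} → Target w → dpar q a ≡ dpar q w
      target-ptr (inj₁ m)          = ptrs _ _ m
      target-ptr (inj₂ (refl , _)) = refl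

      sibling-ptr : dpar q a' ≡ dpar q a
      sibling-ptr = trans (neg⇒justified-by-parent c⋖a' na') (sym (neg⇒justified-by-parent c⋖a na))

      seed : Ctx q
      seed = map (a' ,_) (filter target? (allFin (nev q)))

      seed⁻ : ∀ {u w} → (u , w) ∈ₗ seed → u ≡ a' × Target w
      seed⁻ m with ∈-map⁻ (a' ,_) m
      ... | _ , m' , refl = refl , proj₂ (∈-filter⁻ target? {xs = allFin (nev q)} m')

      seed⁺ : ∀ {w} → Target w → (a' , w) ∈ₗ seed
      seed⁺ t = ∈-map⁺ (a' ,_) (∈-filter⁺ target? (∈-allFin _) t)

      Keep : Fin (nev q) × Fin (nev q) → Set
      Keep (u , _) = ¬ a' ⊑ u × u ≢ a

      keep? : ∀ e → Dec (Keep e)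
      keep? (u , _) = ¬? (a' ⊑? u) ×-dec ¬? (u ≟ a)

      Γ₀ : Ctx q
      Γ₀ = seed ++ filter keep? Γ

      ∈Γ₀⁻ : ∀ {u w} → (u , w) ∈ₗ Γ₀ → (u ≡ a' × Target w) ⊎ ((u , w) ∈ₗ Γ × Keep (u , w))
      ∈Γ₀⁻ m = Sum.map seed⁻ (∈-filter⁻ keep?) (∈-++⁻ seed m)

      functional₀ : ∀ {u w w'} → (u , w) ∈ₗ Γ₀ → (u , w') ∈ₗ Γ₀ → w ≡ w'
      functional₀ m m' with ∈Γ₀⁻ m | ∈Γ₀⁻ m'
      ... | inj₁ (refl , t) | inj₁ (_ , t')   = target-unique t t'
      ... | inj₁ (refl , _) | inj₂ (_ , k)    = ⊥-elim (proj₁ k ε)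
      ... | inj₂ (_ , k)    | inj₁ (refl , _) = ⊥-elim (proj₁ k ε)
      ... | inj₂ (m₁ , _)   | inj₂ (m₂ , _)   = functional _ _ _ m₁ m₂

      injective₀ : ∀ {u u' w} → (u , w) ∈ₗ Γ₀ → (u' , w) ∈ₗ Γ₀ → u ≡ u'
      injective₀ m m' with ∈Γ₀⁻ m | ∈Γ₀⁻ m'
      ... | inj₁ (refl , _) | inj₁ (refl , _) = refl
      ... | inj₁ (refl , t) | inj₂ (m₂ , k)   = ⊥-elim (proj₂ k (target-only-from-a t m₂))
      ... | inj₂ (m₁ , k)   | inj₁ (refl , t) = ⊥-elim (proj₂ k (target-only-from-a t m₁))
      ... | inj₂ (m₁ , _)   | inj₂ (m₂ , _)   = injective _ _ _ m₁ m₂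

      context : IsContext q Γ₀
      context = record
        { negDom     = λ _ _ m → Sum.[ (λ { (refl , _) → na' }) , (λ (m' , _) → negDom _ _ m') ] (∈Γ₀⁻ m)
        ; negCod     = λ _ _ m → Sum.[ (λ (_ , t) → target-neg t) , (λ (m' , _) → negCod _ _ m') ]
                                     (∈Γ₀⁻ m)
        ; dispPres   = λ _ _ m → Sum.[ (λ { (refl , t) → trans (f-disp fa) (target-disp t) })
                                     , (λ (m' , _) → dispPres _ _ m') ] (∈Γ₀⁻ m)
        ; functional = λ _ _ _ → functional₀
        ; injective  = λ _ _ _ → injective₀
        }

      pointers : PreservesPointers q Γ₀
      pointers _ _ m = Sum.[ (λ { (refl , t) → trans sibling-ptr (target-ptr t) })
                           , (λ (m' , _) → ptrs _ _ m') ] (∈Γ₀⁻ m)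

      cod-not-after₀ : ∀ {u w} → (u , w) ∈ₗ Γ₀ → ¬ y ⊏ w
      cod-not-after₀ m with ∈Γ₀⁻ m
      ... | inj₁ (_ , inj₁ m')               = clone-cod-not-after b∼y _ _ m'
      ... | inj₁ (_ , inj₂ (refl , _ , a⊑y)) = λ y⊏a → ⊏⇒⋣ y⊏a a⊑y
      ... | inj₂ (m' , _)                     = clone-cod-not-after b∼y _ _ m'

      invariant : Invariant Γ Γ₀ ((b' , b) ∷ (a' , a) ∷ []) b' b y
      invariant = record
        { path               = correspondence-step (correspondence-start fa) a'⋖b' a⋖b fb
        ; Γ'-functional      = functional₀
        ; same-on-ancestors⁺ = λ j⊑c m → ∈-++⁺ʳ seed (∈-filter⁺ keep? m
                                 ((λ a'⊑j → ⋖⇒⋣ c⋖a' (a'⊑j ◅◅ j⊑c)) , λ { refl → ⋖⇒⋣ c⋖a j⊑c }))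
        ; same-on-ancestors⁻ = λ j⊑c m → Sum.[ (λ { (refl , _) → ⊥-elim (⋖⇒⋣ c⋖a' j⊑c) }) , proj₁ ]
                                               (∈Γ₀⁻ m)
        ; cod-old            = λ m → Sum.[ (λ (_ , t) → cod-of-target t) , (λ (m' , _) → inj₁ (_ , m')) ]
                                         (∈Γ₀⁻ m)
        ; along-path         = along-path₀
        ; along-path-free    = along-path-free₀
        ; dom-not-after      = λ m b'⊏u → Sum.[ (λ { (refl , _) → ⊏⇒⋣ b'⊏u (a'⋖b' ◅ ε) })
                                               , (λ (_ , k) → proj₁ k (a'⋖b' ◅ ⊏⇒⊑ b'⊏u)) ] (∈Γ₀⁻ m)
        ; cod-not-after      = cod-not-after₀
        }
        where
        cod-of-target : ∀ {w} → Target w → (∃ λ v → (v , w) ∈ₗ Γ) ⊎ w ≡ a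
        cod-of-target (inj₁ m)          = inj₁ (a , m)
        cod-of-target (inj₂ (refl , _)) = inj₂ refl
        along-path₀ : ∀ {j' j w} → (j' , j) ∈ₗ (b' , b) ∷ (a' , a) ∷ [] → (j , w) ∈ₗ Γ → (j' , w) ∈ₗ Γ₀
        along-path₀ (here refl)         m = ⊥-elim (pos≢neg (trans (sym pb) (negDom _ _ m)))
        along-path₀ (there (here refl)) m = ∈-++⁺ˡ (seed⁺ (inj₁ m))
        along-path-free₀ : ∀ {j' j} → (j' , j) ∈ₗ (b' , b) ∷ (a' , a) ∷ [] → pol q j ≡ neg → Free Γ j →
                           j ⊑ y → (j' , j) ∈ₗ Γ₀
        along-path-free₀ (here refl)         nb _  _   = ⊥-elim (pos≢neg (trans (sym pb) nb))
        along-path-free₀ (there (here refl)) _  fr a⊑y = ∈-++⁺ˡ (seed⁺ (inj₂ (refl , fr , a⊑y)))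

    sibling-clone : ∀ {Γ b b' y} → IsContext q Γ → PreservesPointers q Γ → Clone Γ b y →
      a ⋖ b → a' ⋖ b' → f b' ≡ f b → pol q b ≡ pos → f a' ≡ f a → _≈_ q b' y
    sibling-clone ctx ptrs b∼y a⋖b a'⋖b' fb pb fa = Γ₀ , context , pointers , transport b∼y invariant
      where open Initial ctx ptrs b∼y a⋖b a'⋖b' fb pb fa

  clone-of-sibling : ∀ {a a' c b y} → c ⋖ a → c ⋖ a' → pol q a' ≡ neg → disp q a' ≡ disp q a →
                     a ⋖ b → pol q b ≡ pos → _≈_ q b y → ∃ λ b' → a' ⋖ b' × _≈_ q b' y
  clone-of-sibling {a} {a'} {c} {b} c⋖a c⋖a' na' da a⋖b pb (Γ , ctx , ptrs , b∼y) =
    let b' , a'⋖b' , fb = proj₂ exp a' (f b) (trans (pol-f b) pb) (subst (P._⋖ f b) (sym fa) (f-⋖ a⋖b))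
    in  b' , a'⋖b' , SiblingTransport.sibling-clone c⋖a c⋖a' ctx ptrs b∼y a⋖b a'⋖b' fb pb fa
    where
    fa : f a' ≡ f a
    fa = p-negLinear (f c) (f a') (f a) (f-⋖ c⋖a') (f-⋖ c⋖a)
           (trans (pol-f a') na') (trans (pol-f a) (pos⇒parent-neg a⋖b pb))
           (trans (presDisp morphism a') (trans da (sym (presDisp morphism a))))

module Counting where

  𝟙 : ∀ {P : Set} → Dec P → ℕ
  𝟙 d = if does d then 1 else 0

  𝟙-yes : ∀ {P : Set} → P → (d : Dec P) → 𝟙 d ≡ 1
  𝟙-yes _  (yes _)  = refl
  𝟙-yes pr (no ¬pr) = ⊥-elim (¬pr pr)

  𝟙-no : ∀ {P : Set} → ¬ P → (d : Dec P) → 𝟙 d ≡ 0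
  𝟙-no ¬pr (yes pr) = ⊥-elim (¬pr pr)
  𝟙-no _   (no _)   = refl

  𝟙-cong : ∀ {P Q : Set} → (P → Q) → (Q → P) → (d : Dec P) (e : Dec Q) → 𝟙 d ≡ 𝟙 e
  𝟙-cong P→Q _   (yes pr) e = sym (𝟙-yes (P→Q pr) e)
  𝟙-cong _   Q→P (no ¬pr) e = sym (𝟙-no (λ qr → ¬pr (Q→P qr)) e)

  count : ∀ {n} {P : Fin n → Set} → (∀ i → Dec (P i)) → ℕ
  count {n} P? = ∑[ i < n ] 𝟙 (P? i)

  count-cong : ∀ {n} {P Q : Fin n → Set} (P? : ∀ i → Dec (P i)) (Q? : ∀ i → Dec (Q i)) →
               (∀ {i} → P i → Q i) → (∀ {i} → Q i → P i) → count P? ≡ count Q?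
  count-cong P? Q? P→Q Q→P = sum-cong-≗ (λ i → 𝟙-cong P→Q Q→P (P? i) (Q? i))

  count-none : ∀ {n} {P : Fin n → Set} (P? : ∀ i → Dec (P i)) → (∀ i → ¬ P i) → count P? ≡ 0
  count-none {n} P? none = trans (sum-cong-≗ (λ i → 𝟙-no (none i) (P? i))) (sum-replicate-zero n)

  count-atMostOne : ∀ {n} {P : Fin n → Set} (P? : ∀ i → Dec (P i)) →
                    (∀ {i j} → P i → P j → i ≡ j) → count P? ≡ 𝟙 (any? P?)
  count-atMostOne {zero}  P? _      = refl
  count-atMostOne {suc n} P? unique with P? Fin.zero
  ... | yes p₀ = cong suc (count-none (λ i → P? (Fin.suc i)) (λ i pᵢ → Finₚ.0≢1+n (unique p₀ pᵢ)))
  ... | no _   = count-atMostOne (λ i → P? (Fin.suc i)) (λ pᵢ pⱼ → Finₚ.suc-injective (unique pᵢ pⱼ))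

  count-range≡count-domain : ∀ {m n} {R : Fin m → Fin n → Set} (R? : ∀ a b → Dec (R a b)) →
    (∀ {a b b'} → R a b → R a b' → b ≡ b') → (∀ {a a' b} → R a b → R a' b → a ≡ a') →
    count (λ b → any? (λ a → R? a b)) ≡ count (λ a → any? (R? a))
  count-range≡count-domain {m} {n} R? functional injective = begin
    ∑[ b < n ] 𝟙 (any? (λ a → R? a b)) ≡⟨ sum-cong-≗ (λ b → count-atMostOne (λ a → R? a b) injective) ⟨
    ∑[ b < n ] ∑[ a < m ] 𝟙 (R? a b)   ≡⟨ ∑-comm (λ a b → 𝟙 (R? a b)) ⟨
    ∑[ a < m ] ∑[ b < n ] 𝟙 (R? a b)   ≡⟨ sum-cong-≗ (λ a → count-atMostOne (R? a) functional) ⟩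
    ∑[ a < m ] 𝟙 (any? (R? a))         ∎
    where open ≡-Reasoning

  count-∖ : ∀ {n} {P Q : Fin n → Set} (P? : ∀ i → Dec (P i)) (Q? : ∀ i → Dec (Q i)) →
            (∀ {i} → Q i → P i) → count P? ≡ count (λ i → P? i ×-dec ¬? (Q? i)) + count Q?
  count-∖ {n} P? Q? Q⊆P =
    trans (sum-cong-≗ {n} split) (∑-distrib-+ (λ i → 𝟙 (P? i ×-dec ¬? (Q? i))) (λ i → 𝟙 (Q? i)))
    where
    split : ∀ i → 𝟙 (P? i) ≡ 𝟙 (P? i ×-dec ¬? (Q? i)) + 𝟙 (Q? i)
    split i with Q? i
    ... | yes qᵢ = trans (𝟙-yes (Q⊆P qᵢ) (P? i))
                         (cong (_+ 1) (sym (𝟙-no (λ (_ , ¬qᵢ) → ¬qᵢ qᵢ) (P? i ×-dec ¬? (yes qᵢ)))))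
    ... | no ¬qᵢ = trans (𝟙-cong (_, ¬qᵢ) proj₁ (P? i) (P? i ×-dec ¬? (no ¬qᵢ))) (sym (+-identityʳ _))

  ∣p∣≡count : ∀ {n} (p : Subset n) → ∣ p ∣ ≡ count (_∈? p)
  ∣p∣≡count []            = refl
  ∣p∣≡count (outside ∷ p) = ∣p∣≡count p
  ∣p∣≡count (inside ∷ p)  = cong suc (∣p∣≡count p)

  fromDec : ∀ {n} {P : Fin n → Set} → (∀ i → Dec (P i)) → Subset n
  fromDec P? = tabulate (λ i → if does (P? i) then inside else outside)

  ∈-fromDec⁺ : ∀ {n} {P : Fin n → Set} (P? : ∀ i → Dec (P i)) {i} → P i → i ∈ fromDec P?
  ∈-fromDec⁺ P? {i} pᵢ = lookup⇒[]= i _ (trans (lookup∘tabulate _ i) (inside-if (P? i)))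
    where
    inside-if : (d : Dec _) → (if does d then inside else outside) ≡ inside
    inside-if (yes _)  = refl
    inside-if (no ¬pᵢ) = ⊥-elim (¬pᵢ pᵢ)

  ∈-fromDec⁻ : ∀ {n} {P : Fin n → Set} (P? : ∀ i → Dec (P i)) {i} → i ∈ fromDec P? → P i
  ∈-fromDec⁻ P? {i} m = from-if (P? i) (trans (sym (lookup∘tabulate _ i)) ([]=⇒lookup m))
    where
    from-if : (d : Dec _) → (if does d then inside else outside) ≡ inside → _
    from-if (yes pᵢ) _ = pᵢ
    from-if (no _)   ()

module BinaryRepresentation where

  binaryValue : List ℕ → ℕ
  binaryValue I = sum (map (2 ^_) I)

  2^-injective : ∀ {i k} → 2 ^ i ≡ 2 ^ k → i ≡ k
  2^-injective {i} {k} e with <-cmp i k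
  ... | tri< i<k _ _ = ⊥-elim (<⇒≢ (^-monoʳ-< 2 (n<1+n 1) i<k) e)
  ... | tri≈ _ i≡k _ = i≡k
  ... | tri> _ _ k<i = ⊥-elim (<⇒≢ (^-monoʳ-< 2 (n<1+n 1) k<i) (sym e))

  halve : List ℕ → List ℕ
  halve []          = []
  halve (zero  ∷ I) = halve I
  halve (suc i ∷ I) = i ∷ halve I

  zeros : List ℕ → ℕ
  zeros []          = 0
  zeros (zero  ∷ I) = suc (zeros I)
  zeros (suc _ ∷ I) = zeros I

  binaryValue-halve : ∀ I → binaryValue I ≡ zeros I + 2 * binaryValue (halve I)
  binaryValue-halve []          = refl
  binaryValue-halve (zero  ∷ I) = cong suc (binaryValue-halve I)
  binaryValue-halve (suc i ∷ I) =
    trans (cong (2 * 2 ^ i +_) (binaryValue-halve I)) (regroup (2 ^ i) (zeros I) (binaryValue (halve I)))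
    where
    regroup : ∀ x z y → 2 * x + (z + 2 * y) ≡ z + 2 * (x + y)
    regroup = solve-∀

  ∈-halve⁺ : ∀ {j} I → suc j ∈ₗ I → j ∈ₗ halve I
  ∈-halve⁺ (zero  ∷ I) (there m)   = ∈-halve⁺ I m
  ∈-halve⁺ (suc _ ∷ I) (here refl) = here refl
  ∈-halve⁺ (suc _ ∷ I) (there m)   = there (∈-halve⁺ I m)

  ∈-halve⁻ : ∀ {j} I → j ∈ₗ halve I → suc j ∈ₗ I
  ∈-halve⁻ (zero  ∷ I) m           = there (∈-halve⁻ I m)
  ∈-halve⁻ (suc _ ∷ I) (here refl) = here refl
  ∈-halve⁻ (suc _ ∷ I) (there m)   = there (∈-halve⁻ I m)

  halve-unique : ∀ {I} → Unique I → Unique (halve I)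
  halve-unique {[]}        []           = []
  halve-unique {zero  ∷ I} (_ ∷ u)      = halve-unique u
  halve-unique {suc _ ∷ I} (i∉I ∷ u) =
    All.tabulate (λ j∈ i≡j → All.lookup i∉I (∈-halve⁻ I j∈) (cong suc i≡j)) ∷ halve-unique u

  0∈⇒zeros≢0 : ∀ {I} → 0 ∈ₗ I → zeros I ≢ 0
  0∈⇒zeros≢0 {zero  ∷ _} _         ()
  0∈⇒zeros≢0 {suc _ ∷ I} (there m) = 0∈⇒zeros≢0 m

  zeros≢0⇒0∈ : ∀ I → zeros I ≢ 0 → 0 ∈ₗ I
  zeros≢0⇒0∈ []          z≢0 = ⊥-elim (z≢0 refl)
  zeros≢0⇒0∈ (zero  ∷ _) _   = here refl
  zeros≢0⇒0∈ (suc _ ∷ I) z≢0 = there (zeros≢0⇒0∈ I z≢0)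

  zeros-0∉ : ∀ {I} → All (0 ≢_) I → zeros I ≡ 0
  zeros-0∉ []                       = refl
  zeros-0∉ {zero  ∷ _} (0≢0 ∷ _)    = ⊥-elim (0≢0 refl)
  zeros-0∉ {suc _ ∷ _} (_ ∷ 0∉I)    = zeros-0∉ 0∉I

  zeros-unique : ∀ {I} → Unique I → zeros I ≤ 1
  zeros-unique {[]}        []        = z≤n
  zeros-unique {zero  ∷ I} (0∉I ∷ _) = s≤s (≤-reflexive (zeros-0∉ 0∉I))
  zeros-unique {suc _ ∷ I} (_ ∷ u)    = zeros-unique u

  bit-parity : ∀ {b b'} x y → b ≤ 1 → b' ≤ 1 → b + 2 * x ≡ b' + 2 * y → b ≡ b' × x ≡ y
  bit-parity {0} {0} x y _ _ e = refl , *-cancelˡ-≡ x y 2 e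
  bit-parity {1} {1} x y _ _ e = refl , *-cancelˡ-≡ x y 2 (suc-injective e)
  bit-parity {0} {1} x y _ _ e = ⊥-elim (even≢odd x y e)
  bit-parity {1} {0} x y _ _ e = ⊥-elim (even≢odd y x (sym e))
  bit-parity {suc (suc _)} _ _ (s≤s ()) _
  bit-parity {0} {suc (suc _)} _ _ _ (s≤s ())
  bit-parity {1} {suc (suc _)} _ _ _ (s≤s ())

  ∈-resp-binaryValue : ∀ {I K} i → Unique I → Unique K → binaryValue I ≡ binaryValue K → i ∈ₗ I → i ∈ₗ K
  ∈-resp-binaryValue {I} {K} i uI uK e i∈I
    with bit-parity (binaryValue (halve I)) (binaryValue (halve K)) (zeros-unique uI) (zeros-unique uK)
           (trans (sym (binaryValue-halve I)) (trans e (binaryValue-halve K)))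
  ∈-resp-binaryValue {I} {K} zero    _  _  _ 0∈I | zI≡zK , _ =
    zeros≢0⇒0∈ K (λ zK≡0 → 0∈⇒zeros≢0 0∈I (trans zI≡zK zK≡0))
  ∈-resp-binaryValue {I} {K} (suc j) uI uK _ j+1∈I | _ , hI≡hK =
    ∈-halve⁻ K (∈-resp-binaryValue j (halve-unique uI) (halve-unique uK) hI≡hK (∈-halve⁺ I j+1∈I))

module ForkDecomposition {A : Arena} (q : Augmentation A) where
  open Counting
  open BinaryRepresentation

  SameFork : Fin (nev q) → Fin (nev q) → Set
  SameFork a x = pol q x ≡ neg × disp q x ≡ disp q a × qpar q x ≡ qpar q a

  sameFork? : ∀ a x → Dec (SameFork a x)
  sameFork? a x =
    (pol q x ≟ₚ neg) ×-dec ((disp q x ≟ disp q a) ×-dec Maybe.≡-dec _≟_ (qpar q x) (qpar q a))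

  forkOf : Fin (nev q) → Subset (nev q)
  forkOf a = fromDec (sameFork? a)

  forkOf-isFork : ∀ {a} → pol q a ≡ neg → Fork q (forkOf a)
  forkOf-isFork {a} na = record
    { nonEmpty = a , ∈-fromDec⁺ (sameFork? a) (na , refl , refl)
    ; negative = λ x x∈ → proj₁ (member x∈)
    ; sameDisp = λ x y x∈ y∈ → trans (proj₁ (proj₂ (member x∈))) (sym (proj₁ (proj₂ (member y∈))))
    ; samePred = λ x y x∈ y∈ → trans (proj₂ (proj₂ (member x∈))) (sym (proj₂ (proj₂ (member y∈))))
    ; maximal  = λ x y x∈ ny dy qy → let _ , dx , qx = member x∈
                                     in  ∈-fromDec⁺ (sameFork? a) (ny , trans dy dx , trans qy qx)
    }
    where
    member : ∀ {x} → x ∈ forkOf a → SameFork a x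
    member = ∈-fromDec⁻ (sameFork? a)

  fork-⊆ : ∀ {X X' x} → Fork q X → Fork q X' → x ∈ X → x ∈ X' → X ⊆ X'
  fork-⊆ {x = x} F F' x∈X x∈X' {z} z∈X =
    Fork.maximal F' x z x∈X' (Fork.negative F z z∈X)
                 (Fork.sameDisp F z x z∈X x∈X) (Fork.samePred F z x z∈X x∈X)

  fork-≡ : ∀ {X X' x} → Fork q X → Fork q X' → x ∈ X → x ∈ X' → X ≡ X'
  fork-≡ F F' x∈X x∈X' = ⊆-antisym (fork-⊆ F F' x∈X x∈X') (fork-⊆ F' F x∈X' x∈X)

  MeetsFork : (Fin (nev q) → Set) → ℕ → Set
  MeetsFork T i = ∃ λ X → Fork q X × ∣ X ∣ ≡ 2 ^ i × ∃ λ a → a ∈ X × T a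

  module _ (distinctCard : ∀ X X' → Fork q X → Fork q X' → ∣ X ∣ ≡ ∣ X' ∣ → X ≡ X')
           (powerOfTwo : ∀ X → Fork q X → ∃ λ k → ∣ X ∣ ≡ 2 ^ k) where

    module WithoutFork {T : Fin (nev q) → Set} (T? : ∀ a → Dec (T a))
                       (negative : ∀ {a} → T a → pol q a ≡ neg) (closed : ∀ {a x} → T a → SameFork a x → T x) {a} (Ta : T a) where

      X = forkOf a
      X-fork = forkOf-isFork (negative Ta)
      k = proj₁ (powerOfTwo X X-fork)
      ∣X∣≡2^k = proj₂ (powerOfTwo X X-fork)

      T' : Fin (nev q) → Set
      T' x = T x × ¬ x ∈ X

      T'? : ∀ x → Dec (T' x)
      T'? x = T? x ×-dec ¬? (x ∈? X)

      T'-negative : ∀ {u} → T' u → pol q u ≡ neg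
      T'-negative (Tu , _) = negative Tu

      T'-closed : ∀ {u x} → T' u → SameFork u x → T' x
      T'-closed {u} {x} (Tu , u∉X) u~x@(_ , dx , qx) =
        closed Tu u~x , λ x∈X → u∉X (Fork.maximal X-fork x u x∈X (negative Tu) (sym dx) (sym qx))

      count-split : count T? ≡ count T'? + 2 ^ k
      count-split = trans (count-∖ T? (_∈? X) (λ x∈X → closed Ta (∈-fromDec⁻ (sameFork? a) x∈X)))
                          (cong (count T'? +_) (trans (sym (∣p∣≡count X)) ∣X∣≡2^k))

      count-T'<count-T : count T'? < count T?
      count-T'<count-T = subst (count T'? <_) (sym count-split) (m<m+n _ (m^n>0 2 k))

      meets-X : MeetsFork T k
      meets-X = X , X-fork , ∣X∣≡2^k , a , ∈-fromDec⁺ (sameFork? a) (negative Ta , refl , refl) , Ta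

      meets-T' : ∀ {i} → MeetsFork T' i → MeetsFork T i
      meets-T' (X' , X'-fork , c , b , b∈X' , (Tb , _)) = X' , X'-fork , c , b , b∈X' , Tb

      ¬meets-T'-k : ¬ MeetsFork T' k
      ¬meets-T'-k (X' , X'-fork , ∣X'∣≡2^k , b , b∈X' , (_ , b∉X)) =
        b∉X (subst (b ∈_) (distinctCard X' X X'-fork X-fork (trans ∣X'∣≡2^k (sym ∣X∣≡2^k))) b∈X')

      meets-T : ∀ {i} → MeetsFork T i → i ≡ k ⊎ MeetsFork T' i
      meets-T {i} (X' , X'-fork , ∣X'∣≡2^i , b , b∈X' , Tb) with b ∈? X
      ... | yes b∈X = inj₁ (2^-injective (begin
                        2 ^ i   ≡⟨ ∣X'∣≡2^i ⟨
                        ∣ X' ∣  ≡⟨ cong ∣_∣ (fork-≡ X'-fork X-fork b∈X' b∈X) ⟩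
                        ∣ X ∣   ≡⟨ ∣X∣≡2^k ⟩
                        2 ^ k   ∎))
        where open ≡-Reasoning
      ... | no b∉X  = inj₂ (X' , X'-fork , ∣X'∣≡2^i , b , b∈X' , Tb , b∉X)

    decompose : ∀ fuel {T} (T? : ∀ a → Dec (T a)) → (∀ {a} → T a → pol q a ≡ neg) →
                (∀ {a x} → T a → SameFork a x → T x) → count T? < fuel →
                ∃ λ K → Unique K × count T? ≡ binaryValue K × (∀ i → i ∈ₗ K ⇔ MeetsFork T i)
    decompose (suc fuel) {T} T? negative closed bound with any? T?
    ... | no ∄T = [] , [] , count-none T? (λ a Ta → ∄T (a , Ta)) ,
                  λ i → mk⇔ (λ ()) (λ (_ , _ , _ , a , _ , Ta) → ⊥-elim (∄T (a , Ta)))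
    ... | yes (a , Ta) = k ∷ K' , k∉K' ∷ uniqueK' , count≡ , membership
      where
      open WithoutFork T? negative closed Ta
      rest = decompose fuel T'? T'-negative T'-closed (<-≤-trans count-T'<count-T (s≤s⁻¹ bound))
      K' = proj₁ rest
      uniqueK' = proj₁ (proj₂ rest)
      K'⇔ = proj₂ (proj₂ (proj₂ rest))
      k∉K' : All (k ≢_) K'
      k∉K' = All.tabulate λ j∈K' k≡j →
        ¬meets-T'-k (subst (MeetsFork T') (sym k≡j) (Equivalence.to (K'⇔ _) j∈K'))
      count≡ : count T? ≡ binaryValue (k ∷ K')
      count≡ = trans count-split
                     (trans (+-comm _ (2 ^ k)) (cong (2 ^ k +_) (proj₁ (proj₂ (proj₂ rest)))))
      membership : ∀ i → i ∈ₗ k ∷ K' ⇔ MeetsFork T i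
      membership i = mk⇔ to from
        where
        from : MeetsFork T i → i ∈ₗ k ∷ K'
        from m = Sum.[ here , (λ m' → there (Equivalence.from (K'⇔ i) m')) ]′ (meets-T m)
        to : i ∈ₗ k ∷ K' → MeetsFork T i
        to (here refl)  = meets-X
        to (there i∈K') = meets-T' {i} (Equivalence.to (K'⇔ i) i∈K')

module CloneClassParents {A : Arena} {p q : Augmentation A}
         (cs : CausalStrategy p) (ch : Characteristic q p) (Y : Subset (nev q)) (cc : CloneClassPos q Y) where
  open AugmentationProperties q
  open ExpansionProperties (CausalStrategy.negLinear cs) (Characteristic.negObsessional ch)
                           (Characteristic.expansion ch)
  open ForkDecomposition q
  open Counting

  y = proj₁ cc

  ∈Y⇒≈y : ∀ {b} → b ∈ Y → _≈_ q b y
  ∈Y⇒≈y = proj₁ (proj₂ (proj₂ cc) _)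

  ≈y⇒∈Y : ∀ {b} → _≈_ q b y → b ∈ Y
  ≈y⇒∈Y = proj₂ (proj₂ (proj₂ cc) _)

  Y-pos : ∀ {b} → b ∈ Y → pol q b ≡ pos
  Y-pos b∈Y with ∈Y⇒≈y b∈Y
  ... | _ , _ , _ , bisim b≃y _ _ _ _ _ _ = trans (cong (polA A) b≃y) (proj₁ (proj₂ cc))

  ParentInY : Fin (nev q) → Fin (nev q) → Set
  ParentInY a b = b ∈ Y × a ⋖ b

  parentInY? : ∀ a b → Dec (ParentInY a b)
  parentInY? a b = (b ∈? Y) ×-dec Maybe.≡-dec _≟_ (qpar q b) (just a)

  HasChildInY : Fin (nev q) → Set
  HasChildInY a = ∃ (ParentInY a)

  hasChildInY? : ∀ a → Dec (HasChildInY a)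
  hasChildInY? a = any? (parentInY? a)

  ∣Y∣≡count-parents : ∣ Y ∣ ≡ count hasChildInY?
  ∣Y∣≡count-parents = begin
    ∣ Y ∣                     ≡⟨ ∣p∣≡count Y ⟩
    count (_∈? Y)             ≡⟨ count-cong (_∈? Y) hasParentInY? has-parent (λ (_ , b∈Y , _) → b∈Y) ⟩
    count hasParentInY?       ≡⟨ count-range≡count-domain parentInY? one-child one-parent ⟩
    count hasChildInY?        ∎
    where
    open ≡-Reasoning
    hasParentInY? : ∀ b → Dec (∃ λ a → ParentInY a b)
    hasParentInY? b = any? (λ a → parentInY? a b)
    has-parent : ∀ {b} → b ∈ Y → ∃ λ a → ParentInY a b
    has-parent b∈Y = let a , a⋖b = pos⇒has-parent (Y-pos b∈Y) in a , b∈Y , a⋖b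
    one-child : ∀ {a b b'} → ParentInY a b → ParentInY a b' → b ≡ b'
    one-child (b∈Y , a⋖b) (b'∈Y , a⋖b') =
      deterministic q _ _ _ (pos⇒parent-neg a⋖b (Y-pos b∈Y)) a⋖b a⋖b' (Y-pos b∈Y) (Y-pos b'∈Y)
    one-parent : ∀ {a a' b} → ParentInY a b → ParentInY a' b → a ≡ a'
    one-parent (_ , a⋖b) (_ , a'⋖b) = just-injective (trans (sym a⋖b) a'⋖b)

  parents-neg : ∀ {a} → HasChildInY a → pol q a ≡ neg
  parents-neg (_ , b∈Y , a⋖b) = pos⇒parent-neg a⋖b (Y-pos b∈Y)

  parents-fork-closed : ∀ {a x} → HasChildInY a → SameFork a x → HasChildInY x
  parents-fork-closed {a} {x} (b , b∈Y , a⋖b) (nx , dx , qx) with qpar q a in qa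
  ... | nothing = subst HasChildInY (qTree q a x qa qx) (b , b∈Y , a⋖b)
  ... | just c  =
    let b' , x⋖b' , b'≈y = clone-of-sibling qa qx nx dx a⋖b (Y-pos b∈Y) (∈Y⇒≈y b∈Y)
    in  b' , ≈y⇒∈Y b'≈y , x⋖b'

lemma37 : (A : Arena) → WellOpened A →
    (p q : Augmentation A) → CausalStrategy p → Characteristic q p →
    (Y : Subset (nev q)) → CloneClassPos q Y →
    (I : List ℕ) → Unique I → ∣ Y ∣ ≡ sum (map (2 ^_) I) →
    (i : ℕ) →
      (i ∈ₗ I) ⇔ (∃ λ X → Fork q X × ∣ X ∣ ≡ 2 ^ i ×
                     ∃ λ a → ∃ λ b → a ∈ X × b ∈ Y × Imm (qpar q) a b)
-- The argument never uses that A is well-opened.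
lemma37 A _ p q cs ch Y cc I uniqueI ∣Y∣≡ΣI i = ⇔-trans I⇔K (⇔-trans (K⇔ i) reassociate)
  where
  open BinaryRepresentation
  open CloneClassParents cs ch Y cc
  open ForkDecomposition q
  decomposition = decompose (Characteristic.distinctCard ch) (Characteristic.powerOfTwo ch)
                    _ hasChildInY? parents-neg parents-fork-closed (n<1+n _)
  K = proj₁ decomposition
  uniqueK = proj₁ (proj₂ decomposition)
  K⇔ = proj₂ (proj₂ (proj₂ decomposition))
  ΣI≡ΣK : binaryValue I ≡ binaryValue K
  ΣI≡ΣK = trans (sym ∣Y∣≡ΣI) (trans ∣Y∣≡count-parents (proj₁ (proj₂ (proj₂ decomposition))))
  I⇔K : i ∈ₗ I ⇔ i ∈ₗ K
  I⇔K = mk⇔ (∈-resp-binaryValue i uniqueI uniqueK ΣI≡ΣK)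
            (∈-resp-binaryValue i uniqueK uniqueI (sym ΣI≡ΣK))
  reassociate : MeetsFork HasChildInY i ⇔
                (∃ λ X → Fork q X × ∣ X ∣ ≡ 2 ^ i × ∃ λ a → ∃ λ b → a ∈ X × b ∈ Y × Imm (qpar q) a b)
  reassociate = mk⇔ (λ (X , F , c , a , a∈X , b , b∈Y , a⋖b) → X , F , c , a , b , a∈X , b∈Y , a⋖b)
                    (λ (X , F , c , a , b , a∈X , b∈Y , a⋖b) → X , F , c , a , a∈X , b , b∈Y , a⋖b)
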